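{- Let $L < N \le 2L$ be positive integers and let $\boldsymbol\xi_1, \dots, \boldsymbol\xi_L$ be points of $F_N$. Then $$\|\boldsymbol\xi_1 \wedge \boldsymbol\xi_2 \wedge \cdots \wedge \boldsymbol\xi_L\|_1 \le \Bigl(\frac{N}{N-L}\Bigr)^{N-L}.$$
   Context: $F_N = \{\boldsymbol e_m - \boldsymbol e_n : 1\le m,n\le N,\ m\ne n\}$ with $\boldsymbol e_m$ the standard basis vectors of $\mathbb{R}^N$. With $\Xi$ the $N\times L$ matrix with columns $\boldsymbol\xi_\ell$ and $\Xi_I$ its submatrix of rows indexed by $I$, $\|\boldsymbol\xi_1\wedge\cdots\wedge\boldsymbol\xi_L\|_1 = \sum_{I\subseteq\{1,\dots,N\},|I|=L}|\det\Xi_I|$. -}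

module Defs where

open import Data.Nat as ℕ using (ℕ; zero; suc)
open import Data.Integer as ℤ using (ℤ; +_; -_; _*_; _-_)
open import Data.Fin using (Fin; zero; suc; punchIn; _≟_)
open import Data.Vec using (Vec; []; _∷_; lookup)
import Data.Vec as Vec
open import Data.List using (List; []; _∷_; _++_; map)
open import Data.Product using (∃₂; _×_)
open import Relation.Nullary using (¬_; does)
open import Relation.Binary.PropositionalEquality using (_≡_)
open import Data.Bool using (if_then_else_)

e : {N : ℕ} → Fin N → Fin N → ℤ
e m i = if does (m ≟ i) then + 1 else + 0

InF : (N : ℕ) → (Fin N → ℤ) → Set
InF N ξ = ∃₂ λ (m n : Fin N) → ¬ (m ≡ n) × (∀ i → ξ i ≡ e m i - e n i)

alt-sum : (n : ℕ) → (Fin n → ℤ) → ℤ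
alt-sum zero    f = + 0
alt-sum (suc n) f = f zero - alt-sum n (λ j → f (suc j))

det : (n : ℕ) → (Fin n → Fin n → ℤ) → ℤ
det zero    M = + 1
det (suc n) M = alt-sum (suc n) λ j → M zero j * det n (λ i k → M (suc i) (punchIn j k))

-- all strictly increasing sequences i₁ < … < i_k in Fin n,
-- i.e. all k-element subsets of {0,…,n-1}, each listed in increasing order
subsets : (k n : ℕ) → List (Vec (Fin n) k)
subsets zero    n       = [] ∷ []
subsets (suc k) zero    = []
subsets (suc k) (suc n) =
  map (λ v → zero ∷ Vec.map suc v) (subsets k n) ++ map (Vec.map suc) (subsets (suc k) n)

sumℕ : List ℕ → ℕ
sumℕ []       = 0
sumℕ (x ∷ xs) = x ℕ.+ sumℕ xs

subMatrix : {N L : ℕ} → (Fin L → Fin N → ℤ) → Vec (Fin N) L → Fin L → Fin L → ℤ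
subMatrix ξ I r ℓ = ξ ℓ (lookup I r)

wedgeNorm1 : (N L : ℕ) → (Fin L → Fin N → ℤ) → ℕ
wedgeNorm1 N L ξ = sumℕ (map (λ I → ℤ.∣ det L (subMatrix ξ I) ∣) (subsets L N))

{-# OPTIONS --safe #-}
-- The bound holds in a weighted form: for weights w on the rows put
-- W(ξ, w) = Σ_{|I| = L} |det Ξ_I| ∏_{i ∉ I} w_i; then W(ξ, w) k^k ≤ (Σ w)^k with k = N − L whenever
-- every column is e_p − e_q or ±e_p, i.e. an incidence vector of a graph on the rows plus a ground
-- vertex. Induct on N, looking at row 0. If no edge meets vertex 0, row 0 vanishes,
-- W(ξ, w) = w_0 W(ξ′, w′) for the remaining rows, and AM-GM for w_0 and k − 1 copies of Σ w′ / (k − 1)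
-- closes the step. If two edges meet vertex 0, subtracting one from the other is a column operation
-- that leaves every minor unchanged and replaces it by an edge avoiding 0. If exactly one edge meets
-- vertex 0, say at its other end a, expanding along row 0 and contracting that edge gives
-- W(ξ, w) = W(η, w′) + w_0 W(±e_a ∷ η, w′), which is W(η, w′ + w_0 e_a) because W is affine in the
-- weight of row a with exactly that slope; N, L drop by one and Σ w is preserved.
module Submission where

open import Defs
open import Data.Nat using (ℕ; _≤_; _<_; _*_; _∸_; _^_)
open import Data.Integer using (ℤ)
open import Data.Fin using (Fin)

open import Data.Nat using (zero; suc; _+_; z≤n; s≤s; >-nonZero)
import Data.Nat.Properties as ℕ
open import Data.Nat.Tactic.RingSolver using () renaming (solve-∀ to ℕ-solve-∀)
open import Data.Integer as ℤ using (+0; +[1+_]; -[1+_]; -_; 0ℤ; 1ℤ; -1ℤ; ∣_∣; _◃_)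
import Data.Integer.Properties as ℤ
open import Data.Integer.Tactic.RingSolver using (solve-∀)
open import Data.Sign using (Sign; opposite)
open import Data.Bool using (Bool; true; false; if_then_else_; _xor_)
import Data.Bool.Properties as Bool
open import Data.Maybe using (Maybe; just; nothing)
import Data.Maybe as Maybe
open import Data.Product using (∃; _×_; _,_; swap)
open import Data.Fin using (zero; suc; punchIn; punchOut; inject₁; _≟_)
import Data.Fin.Properties as Fin
open import Data.List using (List; []; _∷_; _++_; map)
import Data.List.Properties as List
open import Data.Vec using (Vec; []; _∷_; lookup)
import Data.Vec as Vec
import Data.Vec.Properties as Vec
open import Data.Vec.Functional as Vector using (tail; updateAt)
open import Data.Vec.Functional.Properties using (updateAt-id-local)
open import Algebra.Properties.Monoid.Sum ℕ.+-0-monoid using (sum)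
open import Function using (_∘_; const)
open import Function.Definitions using (Injective)
open import Relation.Nullary using (yes; no; does; contradiction)
open import Relation.Binary.PropositionalEquality

-- Alternating sums and determinants

sign : ∀ {n} → Fin n → ℤ
sign zero    = 1ℤ
sign (suc j) = - sign j

∣sign∣≡1 : ∀ {n} (j : Fin n) → ∣ sign j ∣ ≡ 1
∣sign∣≡1 zero    = refl
∣sign∣≡1 (suc j) = trans (ℤ.∣-i∣≡∣i∣ (sign j)) (∣sign∣≡1 j)

∣sign*unit*x∣≡∣x∣ : ∀ {n} (r : Fin n) u x → ∣ u ∣ ≡ 1 → ∣ sign r ℤ.* (u ℤ.* x) ∣ ≡ ∣ x ∣
∣sign*unit*x∣≡∣x∣ r u x ∣u∣≡1 = begin
  ∣ sign r ℤ.* (u ℤ.* x) ∣       ≡⟨ ℤ.abs-* (sign r) (u ℤ.* x) ⟩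
  ∣ sign r ∣ * ∣ u ℤ.* x ∣       ≡⟨ cong₂ _*_ (∣sign∣≡1 r) (ℤ.abs-* u x) ⟩
  1 * (∣ u ∣ * ∣ x ∣)            ≡⟨ cong (λ y → 1 * (y * ∣ x ∣)) ∣u∣≡1 ⟩
  1 * (1 * ∣ x ∣)                ≡⟨ trans (ℕ.*-identityˡ _) (ℕ.*-identityˡ _) ⟩
  ∣ x ∣                          ∎
  where open ≡-Reasoning

alt-sum-cong : ∀ n {f g : Fin n → ℤ} → (∀ j → f j ≡ g j) → alt-sum n f ≡ alt-sum n g
alt-sum-cong zero    f≗g = refl
alt-sum-cong (suc n) f≗g = cong₂ ℤ._-_ (f≗g zero) (alt-sum-cong n (f≗g ∘ suc))

alt-sum-zero : ∀ n {f : Fin n → ℤ} → (∀ j → f j ≡ 0ℤ) → alt-sum n f ≡ 0ℤ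
alt-sum-zero zero    f≗0 = refl
alt-sum-zero (suc n) f≗0 rewrite f≗0 zero | alt-sum-zero n (f≗0 ∘ suc) = refl

alt-sum-single : ∀ n (f : Fin n → ℤ) j → (∀ l → l ≢ j → f l ≡ 0ℤ) → alt-sum n f ≡ sign j ℤ.* f j
alt-sum-single (suc n) f zero f≗0
  rewrite alt-sum-zero n (λ l → f≗0 (suc l) λ ()) = regroup (f zero)
  where
  regroup : ∀ a → a ℤ.- 0ℤ ≡ 1ℤ ℤ.* a
  regroup = solve-∀
alt-sum-single (suc n) f (suc j) f≗0
  rewrite f≗0 zero (λ ())
        | alt-sum-single n (tail f) j (λ l l≢j → f≗0 (suc l) (l≢j ∘ Fin.suc-injective))
  = regroup (sign j) (f (suc j))
  where
  regroup : ∀ s a → 0ℤ ℤ.- s ℤ.* a ≡ (- s) ℤ.* a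
  regroup = solve-∀

alt-sum-neg : ∀ n (f : Fin n → ℤ) → alt-sum n (-_ ∘ f) ≡ - alt-sum n f
alt-sum-neg zero    f = refl
alt-sum-neg (suc n) f rewrite alt-sum-neg n (tail f) = regroup (f zero) (alt-sum n (tail f))
  where
  regroup : ∀ a b → (- a) ℤ.- (- b) ≡ - (a ℤ.- b)
  regroup = solve-∀

alt-sum-scale : ∀ n (f h : Fin n → ℤ) t → (∀ j → h j ≡ t ℤ.* f j) → alt-sum n h ≡ t ℤ.* alt-sum n f
alt-sum-scale zero    f h t h≗tf = sym (ℤ.*-zeroʳ t)
alt-sum-scale (suc n) f h t h≗tf
  rewrite h≗tf zero | alt-sum-scale n (tail f) (tail h) t (h≗tf ∘ suc)
  = regroup t (f zero) (alt-sum n (tail f))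
  where
  regroup : ∀ t a x → t ℤ.* a ℤ.- t ℤ.* x ≡ t ℤ.* (a ℤ.- x)
  regroup = solve-∀

alt-sum-linear : ∀ n (f g h : Fin n → ℤ) t → (∀ j → h j ≡ f j ℤ.+ t ℤ.* g j) →
  alt-sum n h ≡ alt-sum n f ℤ.+ t ℤ.* alt-sum n g
alt-sum-linear zero    f g h t h≗f+tg = cong (λ x → 0ℤ ℤ.+ x) (sym (ℤ.*-zeroʳ t))
alt-sum-linear (suc n) f g h t h≗f+tg
  rewrite h≗f+tg zero | alt-sum-linear n (tail f) (tail g) (tail h) t (h≗f+tg ∘ suc)
  = regroup (f zero) (g zero) t (alt-sum n (tail f)) (alt-sum n (tail g))
  where
  regroup : ∀ a b t x y → (a ℤ.+ t ℤ.* b) ℤ.- (x ℤ.+ t ℤ.* y) ≡ (a ℤ.- x) ℤ.+ t ℤ.* (b ℤ.- y)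
  regroup = solve-∀

swapAdj : ∀ {n} → Fin n → Fin (suc n) → Fin (suc n)
swapAdj zero    zero          = suc zero
swapAdj zero    (suc zero)    = zero
swapAdj zero    (suc (suc i)) = suc (suc i)
swapAdj (suc k) zero          = zero
swapAdj (suc k) (suc i)       = suc (swapAdj k i)

alt-sum-swapAdj : ∀ n (k : Fin n) (f g : Fin (suc n) → ℤ) →
  (∀ j → swapAdj k j ≡ j → f j ≡ - g j) → f (inject₁ k) ≡ g (suc k) → f (suc k) ≡ g (inject₁ k) →
  alt-sum (suc n) f ≡ - alt-sum (suc n) g
alt-sum-swapAdj (suc n) zero f g fixed f₀≡g₁ f₁≡g₀ rewrite f₀≡g₁ | f₁≡g₀ =
  trans (cong (λ x → g (suc zero) ℤ.- (g zero ℤ.- x)) tail≡)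
        (regroup (g zero) (g (suc zero)) (alt-sum n (tail (tail g))))
  where
  tail≡ : alt-sum n (tail (tail f)) ≡ - alt-sum n (tail (tail g))
  tail≡ = trans (alt-sum-cong n (λ j → fixed (suc (suc j)) refl)) (alt-sum-neg n (tail (tail g)))
  regroup : ∀ a b x → b ℤ.- (a ℤ.- (- x)) ≡ - (a ℤ.- (b ℤ.- x))
  regroup = solve-∀
alt-sum-swapAdj (suc n) (suc k) f g fixed f₀≡g₁ f₁≡g₀
  rewrite fixed zero refl
        | alt-sum-swapAdj n k (tail f) (tail g) (λ j e → fixed (suc j) (cong suc e)) f₀≡g₁ f₁≡g₀
  = regroup (g zero) (alt-sum (suc n) (tail g))
  where
  regroup : ∀ a x → (- a) ℤ.- (- x) ≡ - (a ℤ.- x)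
  regroup = solve-∀

Matrix : ℕ → Set
Matrix n = Fin n → Fin n → ℤ

minor : ∀ {n} → Matrix (suc n) → Fin (suc n) → Matrix n
minor M j i k = M (suc i) (punchIn j k)

det-cong : ∀ n {M M' : Matrix n} → (∀ i j → M i j ≡ M' i j) → det n M ≡ det n M'
det-cong zero    M≗M' = refl
det-cong (suc n) M≗M' =
  alt-sum-cong (suc n) λ j → cong₂ ℤ._*_ (M≗M' zero j) (det-cong n λ i k → M≗M' (suc i) (punchIn j k))

det-zeroColumn : ∀ n (M : Matrix (suc n)) j → (∀ i → M i j ≡ 0ℤ) → det (suc n) M ≡ 0ℤ
det-zeroColumn zero    M zero Mj≡0 = cong (λ x → x ℤ.* 1ℤ ℤ.- 0ℤ) (Mj≡0 zero)
det-zeroColumn (suc n) M j    Mj≡0 = alt-sum-zero (suc (suc n)) term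
  where
  term : ∀ l → M zero l ℤ.* det (suc n) (minor M l) ≡ 0ℤ
  term l with l ≟ j
  ... | yes refl = trans (cong (ℤ._* det (suc n) (minor M l)) (Mj≡0 zero)) (ℤ.*-zeroˡ (det (suc n) (minor M l)))
  ... | no l≢j   = trans (cong (M zero l ℤ.*_) (det-zeroColumn n (minor M l) (punchOut l≢j) minor≡0))
                         (ℤ.*-zeroʳ (M zero l))
    where
    minor≡0 : ∀ i → minor M l i (punchOut l≢j) ≡ 0ℤ
    minor≡0 i = trans (cong (M (suc i)) (Fin.punchIn-punchOut l≢j)) (Mj≡0 (suc i))

expansionTerm-suc≡0 : ∀ {n} (M : Matrix (suc n)) → (∀ i → M (suc i) zero ≡ 0ℤ) →
  ∀ l → M zero (suc l) ℤ.* det n (minor M (suc l)) ≡ 0ℤ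
expansionTerm-suc≡0 {suc n} M col₀≡0 l =
  trans (cong (M zero (suc l) ℤ.*_) (det-zeroColumn n (minor M (suc l)) zero col₀≡0)) (ℤ.*-zeroʳ (M zero (suc l)))

det-unitColumn₀ : ∀ n (M : Matrix (suc n)) r u → M r zero ≡ u → (∀ i → i ≢ r → M i zero ≡ 0ℤ) →
  det (suc n) M ≡ sign r ℤ.* (u ℤ.* det n (λ i k → M (punchIn r i) (suc k)))
det-unitColumn₀ n M zero u Mr≡u M≡0 =
  trans (alt-sum-single (suc n) _ zero terms≡0) (cong (λ x → 1ℤ ℤ.* (x ℤ.* det n (minor M zero))) Mr≡u)
  where
  terms≡0 : ∀ l → l ≢ zero → M zero l ℤ.* det n (minor M l) ≡ 0ℤ
  terms≡0 zero    l≢0 = contradiction refl l≢0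
  terms≡0 (suc l) _   = expansionTerm-suc≡0 M (λ i → M≡0 (suc i) λ ()) l
det-unitColumn₀ (suc n) M (suc r) u Mr≡u M≡0 = begin
  M zero zero ℤ.* det (suc n) (minor M zero) ℤ.- alt-sum (suc n) (λ l → M zero (suc l) ℤ.* det (suc n) (minor M (suc l)))
    ≡⟨ cong₂ ℤ._-_ first≡0 (alt-sum-scale (suc n) _ _ (sign r ℤ.* u) factor) ⟩
  0ℤ ℤ.- (sign r ℤ.* u) ℤ.* det (suc n) M′
    ≡⟨ regroup (sign r) u (det (suc n) M′) ⟩
  (- sign r) ℤ.* (u ℤ.* det (suc n) M′) ∎
  where
  open ≡-Reasoning
  M′ : Matrix (suc n)
  M′ i k = M (punchIn (suc r) i) (suc k)
  first≡0 : M zero zero ℤ.* det (suc n) (minor M zero) ≡ 0ℤ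
  first≡0 = trans (cong (ℤ._* det (suc n) (minor M zero)) (M≡0 zero λ ())) (ℤ.*-zeroˡ (det (suc n) (minor M zero)))
  -- once sign r · u is factored out, the remaining alternating sum is the expansion of det M′
  factor : ∀ l → M zero (suc l) ℤ.* det (suc n) (minor M (suc l)) ≡ (sign r ℤ.* u) ℤ.* (M zero (suc l) ℤ.* det n (minor M′ l))
  factor l = trans (cong (M zero (suc l) ℤ.*_)
                     (det-unitColumn₀ n (minor M (suc l)) r u Mr≡u (λ i i≢r → M≡0 (suc i) (i≢r ∘ Fin.suc-injective))))
                   (regroup′ (M zero (suc l)) (sign r) u (det n (minor M′ l)))
    where
    regroup′ : ∀ a s u d → a ℤ.* (s ℤ.* (u ℤ.* d)) ≡ (s ℤ.* u) ℤ.* (a ℤ.* d)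
    regroup′ = solve-∀
  regroup : ∀ s u d → 0ℤ ℤ.- (s ℤ.* u) ℤ.* d ≡ (- s) ℤ.* (u ℤ.* d)
  regroup = solve-∀

withColumn₀ : ∀ {n} → Matrix (suc n) → (Fin (suc n) → ℤ) → Matrix (suc n)
withColumn₀ M c i zero    = c i
withColumn₀ M c i (suc k) = M i (suc k)

det-linear₀ : ∀ n (M : Matrix (suc n)) (a b : Fin (suc n) → ℤ) t →
  det (suc n) (withColumn₀ M (λ i → a i ℤ.+ t ℤ.* b i)) ≡
  det (suc n) (withColumn₀ M a) ℤ.+ t ℤ.* det (suc n) (withColumn₀ M b)
det-linear₀ zero    M a b t = regroup (a zero) t (b zero)
  where
  regroup : ∀ a t b → (a ℤ.+ t ℤ.* b) ℤ.* 1ℤ ℤ.- 0ℤ ≡ (a ℤ.* 1ℤ ℤ.- 0ℤ) ℤ.+ t ℤ.* (b ℤ.* 1ℤ ℤ.- 0ℤ)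
  regroup = solve-∀
det-linear₀ (suc n) M a b t = alt-sum-linear (suc (suc n)) (T a) (T b) (T a+tb) t term
  where
  a+tb : Fin (suc (suc n)) → ℤ
  a+tb i = a i ℤ.+ t ℤ.* b i
  T : (Fin (suc (suc n)) → ℤ) → Fin (suc (suc n)) → ℤ
  T c j = withColumn₀ M c zero j ℤ.* det (suc n) (minor (withColumn₀ M c) j)
  D : (Fin (suc (suc n)) → ℤ) → Fin (suc n) → ℤ
  D c j = det (suc n) (minor (withColumn₀ M c) (suc j))
  minor-suc : ∀ c j → D c j ≡ det (suc n) (withColumn₀ (minor M (suc j)) (tail c))
  minor-suc c j = det-cong (suc n) {minor (withColumn₀ M c) (suc j)} {withColumn₀ (minor M (suc j)) (tail c)}
                            λ { i zero → refl ; i (suc k) → refl }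
  term : ∀ j → T a+tb j ≡ T a j ℤ.+ t ℤ.* T b j
  term zero    = regroup (a zero) t (b zero) (det (suc n) (minor M zero))
    where
    regroup : ∀ a t b d → (a ℤ.+ t ℤ.* b) ℤ.* d ≡ a ℤ.* d ℤ.+ t ℤ.* (b ℤ.* d)
    regroup = solve-∀
  term (suc j) = begin
    M zero (suc j) ℤ.* D a+tb j
      ≡⟨ cong (M zero (suc j) ℤ.*_) (trans (minor-suc a+tb j) (det-linear₀ n (minor M (suc j)) (tail a) (tail b) t)) ⟩
    M zero (suc j) ℤ.* (det (suc n) (withColumn₀ (minor M (suc j)) (tail a)) ℤ.+
                        t ℤ.* det (suc n) (withColumn₀ (minor M (suc j)) (tail b)))
      ≡⟨ regroup (M zero (suc j)) t _ _ ⟩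
    M zero (suc j) ℤ.* det (suc n) (withColumn₀ (minor M (suc j)) (tail a)) ℤ.+
    t ℤ.* (M zero (suc j) ℤ.* det (suc n) (withColumn₀ (minor M (suc j)) (tail b)))
      ≡⟨ sym (cong₂ (λ x y → M zero (suc j) ℤ.* x ℤ.+ t ℤ.* (M zero (suc j) ℤ.* y)) (minor-suc a j) (minor-suc b j)) ⟩
    M zero (suc j) ℤ.* D a j ℤ.+ t ℤ.* (M zero (suc j) ℤ.* D b j) ∎
    where
    open ≡-Reasoning
    regroup : ∀ m t x y → m ℤ.* (x ℤ.+ t ℤ.* y) ≡ m ℤ.* x ℤ.+ t ℤ.* (m ℤ.* y)
    regroup = solve-∀

swapAdj-inject₁ : ∀ {n} (k : Fin n) → swapAdj k (inject₁ k) ≡ suc k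
swapAdj-inject₁ zero    = refl
swapAdj-inject₁ (suc k) = cong suc (swapAdj-inject₁ k)

swapAdj-suc : ∀ {n} (k : Fin n) → swapAdj k (suc k) ≡ inject₁ k
swapAdj-suc zero    = refl
swapAdj-suc (suc k) = cong suc (swapAdj-suc k)

swapAdj-punchIn-inject₁ : ∀ {n} (k : Fin n) l → swapAdj k (punchIn (inject₁ k) l) ≡ punchIn (suc k) l
swapAdj-punchIn-inject₁ zero    zero    = refl
swapAdj-punchIn-inject₁ zero    (suc l) = refl
swapAdj-punchIn-inject₁ (suc k) zero    = refl
swapAdj-punchIn-inject₁ (suc k) (suc l) = cong suc (swapAdj-punchIn-inject₁ k l)

swapAdj-punchIn-suc : ∀ {n} (k : Fin n) l → swapAdj k (punchIn (suc k) l) ≡ punchIn (inject₁ k) l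
swapAdj-punchIn-suc zero    zero    = refl
swapAdj-punchIn-suc zero    (suc l) = refl
swapAdj-punchIn-suc (suc k) zero    = refl
swapAdj-punchIn-suc (suc k) (suc l) = cong suc (swapAdj-punchIn-suc k l)

swapAdj-punchIn-fixed : ∀ {n} (k : Fin (suc n)) j → swapAdj k j ≡ j →
  ∃ λ k′ → ∀ l → swapAdj k (punchIn j l) ≡ punchIn j (swapAdj k′ l)
swapAdj-punchIn-fixed zero zero ()
swapAdj-punchIn-fixed zero (suc zero) ()
swapAdj-punchIn-fixed {suc n} zero (suc (suc j)) _ = zero , λ { zero → refl ; (suc zero) → refl ; (suc (suc l)) → refl }
swapAdj-punchIn-fixed (suc k) zero _ = k , λ l → refl
swapAdj-punchIn-fixed {suc n} (suc k) (suc j) fixed with swapAdj-punchIn-fixed k j (Fin.suc-injective fixed)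
... | k′ , commutes = suc k′ , λ { zero → refl ; (suc l) → cong suc (commutes l) }

det-swapAdj : ∀ n (k : Fin n) (M : Matrix (suc n)) → det (suc n) (λ i j → M i (swapAdj k j)) ≡ - det (suc n) M
det-swapAdj (suc n) k M = alt-sum-swapAdj (suc n) k _ _ fixed inject₁↦suc suc↦inject₁
  where
  fixed : ∀ j → swapAdj k j ≡ j →
    M zero (swapAdj k j) ℤ.* det (suc n) (λ i l → M (suc i) (swapAdj k (punchIn j l))) ≡
    - (M zero j ℤ.* det (suc n) (minor M j))
  fixed j k↦j with swapAdj-punchIn-fixed k j k↦j
  ... | k′ , commutes =
    trans (cong₂ ℤ._*_ (cong (M zero) k↦j)
                       (trans (det-cong (suc n) λ i l → cong (M (suc i)) (commutes l))
                              (det-swapAdj n k′ (minor M j))))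
          (sym (ℤ.neg-distribʳ-* (M zero j) (det (suc n) (minor M j))))
  inject₁↦suc : M zero (swapAdj k (inject₁ k)) ℤ.* det (suc n) (λ i l → M (suc i) (swapAdj k (punchIn (inject₁ k) l))) ≡
                M zero (suc k) ℤ.* det (suc n) (minor M (suc k))
  inject₁↦suc = cong₂ ℤ._*_ (cong (M zero) (swapAdj-inject₁ k))
                            (det-cong (suc n) λ i l → cong (M (suc i)) (swapAdj-punchIn-inject₁ k l))
  suc↦inject₁ : M zero (swapAdj k (suc k)) ℤ.* det (suc n) (λ i l → M (suc i) (swapAdj k (punchIn (suc k) l))) ≡
                M zero (inject₁ k) ℤ.* det (suc n) (minor M (inject₁ k))
  suc↦inject₁ = cong₂ ℤ._*_ (cong (M zero) (swapAdj-suc k))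
                            (det-cong (suc n) λ i l → cong (M (suc i)) (swapAdj-punchIn-suc k l))

x≡-x⇒x≡0 : ∀ x → x ≡ - x → x ≡ 0ℤ
x≡-x⇒x≡0 +0         _  = refl
x≡-x⇒x≡0 +[1+ n ]   ()
x≡-x⇒x≡0 -[1+ n ]   ()

det-equalColumns₀₁ : ∀ n (M : Matrix (suc (suc n))) → (∀ i → M i zero ≡ M i (suc zero)) → det (suc (suc n)) M ≡ 0ℤ
det-equalColumns₀₁ n M col₀≡col₁ =
  x≡-x⇒x≡0 (det (suc (suc n)) M) (trans (sym (det-cong (suc (suc n)) swap-invariant)) (det-swapAdj (suc n) zero M))
  where
  swap-invariant : ∀ i j → M i (swapAdj zero j) ≡ M i j
  swap-invariant i zero          = sym (col₀≡col₁ i)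
  swap-invariant i (suc zero)    = col₀≡col₁ i
  swap-invariant i (suc (suc j)) = refl

det-addColumn₁To₀ : ∀ n (M : Matrix (suc (suc n))) t →
  det (suc (suc n)) (withColumn₀ M (λ i → M i zero ℤ.+ t ℤ.* M i (suc zero))) ≡ det (suc (suc n)) M
det-addColumn₁To₀ n M t = begin
  det (suc (suc n)) (withColumn₀ M (λ i → M i zero ℤ.+ t ℤ.* M i (suc zero)))
    ≡⟨ det-linear₀ (suc n) M (λ i → M i zero) (λ i → M i (suc zero)) t ⟩
  det (suc (suc n)) (withColumn₀ M (λ i → M i zero)) ℤ.+ t ℤ.* det (suc (suc n)) (withColumn₀ M (λ i → M i (suc zero)))
    ≡⟨ cong₂ (λ x y → x ℤ.+ t ℤ.* y)
             (det-cong (suc (suc n)) {withColumn₀ M (λ i → M i zero)} {M} λ { i zero → refl ; i (suc k) → refl })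
                                      (det-equalColumns₀₁ n (withColumn₀ M (λ i → M i (suc zero))) λ i → refl) ⟩
  det (suc (suc n)) M ℤ.+ t ℤ.* 0ℤ
    ≡⟨ trans (cong (λ x → det (suc (suc n)) M ℤ.+ x) (ℤ.*-zeroʳ t)) (ℤ.+-identityʳ _) ⟩
  det (suc (suc n)) M ∎
  where open ≡-Reasoning

swapAdjs : ∀ {n} → List (Fin n) → Fin (suc n) → Fin (suc n)
swapAdjs []       j = j
swapAdjs (k ∷ ks) j = swapAdj k (swapAdjs ks j)

swapAdjs-++ : ∀ {n} (ks ks′ : List (Fin n)) j → swapAdjs (ks ++ ks′) j ≡ swapAdjs ks (swapAdjs ks′ j)
swapAdjs-++ []       ks′ j = refl
swapAdjs-++ (k ∷ ks) ks′ j = cong (swapAdj k) (swapAdjs-++ ks ks′ j)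

swapAdjs-map-suc-zero : ∀ {n} (ks : List (Fin n)) → swapAdjs (map suc ks) zero ≡ zero
swapAdjs-map-suc-zero []       = refl
swapAdjs-map-suc-zero (k ∷ ks) = cong (swapAdj (suc k)) (swapAdjs-map-suc-zero ks)

swapAdjs-map-suc-suc : ∀ {n} (ks : List (Fin n)) j → swapAdjs (map suc ks) (suc j) ≡ suc (swapAdjs ks j)
swapAdjs-map-suc-suc []       j = refl
swapAdjs-map-suc-suc (k ∷ ks) j = cong (swapAdj (suc k)) (swapAdjs-map-suc-suc ks j)

∣det∣-swapAdjs : ∀ n (ks : List (Fin n)) (M : Matrix (suc n)) →
  ∣ det (suc n) (λ i j → M i (swapAdjs ks j)) ∣ ≡ ∣ det (suc n) M ∣
∣det∣-swapAdjs n []       M = refl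
∣det∣-swapAdjs n (k ∷ ks) M = begin
  ∣ det (suc n) (λ i j → M i (swapAdj k (swapAdjs ks j))) ∣ ≡⟨ ∣det∣-swapAdjs n ks (λ i j → M i (swapAdj k j)) ⟩
  ∣ det (suc n) (λ i j → M i (swapAdj k j)) ∣                ≡⟨ cong ∣_∣ (det-swapAdj n k M) ⟩
  ∣ - det (suc n) M ∣                                         ≡⟨ ℤ.∣-i∣≡∣i∣ (det (suc n) M) ⟩
  ∣ det (suc n) M ∣                                           ∎
  where open ≡-Reasoning

toFront : ∀ {n} → Fin (suc n) → Fin (suc n) → Fin (suc n)
toFront k zero    = k
toFront k (suc j) = punchIn k j

-- toFront (k + 1) = lift (toFront k) ∘ swapAdj 0
toFront-swapAdjs : ∀ {n} (k : Fin (suc n)) → ∃ λ ks → ∀ j → toFront k j ≡ swapAdjs ks j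
toFront-swapAdjs zero = [] , λ { zero → refl ; (suc j) → refl }
toFront-swapAdjs {suc n} (suc k) with toFront-swapAdjs k
... | ks , toFront≗ = map suc ks ++ zero ∷ [] , λ j → trans (lifted j) (sym (swapAdjs-++ (map suc ks) (zero ∷ []) j))
  where
  lifted : ∀ j → toFront (suc k) j ≡ swapAdjs (map suc ks) (swapAdj zero j)
  lifted zero          = trans (cong suc (toFront≗ zero)) (sym (swapAdjs-map-suc-suc ks zero))
  lifted (suc zero)    = sym (swapAdjs-map-suc-zero ks)
  lifted (suc (suc j)) = trans (cong suc (toFront≗ (suc j))) (sym (swapAdjs-map-suc-suc ks (suc j)))

∣det∣-toFront : ∀ n (k : Fin (suc n)) (M : Matrix (suc n)) →
  ∣ det (suc n) (λ i j → M i (toFront k j)) ∣ ≡ ∣ det (suc n) M ∣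
∣det∣-toFront n k M with toFront-swapAdjs k
... | ks , toFront≗ = trans (cong ∣_∣ (det-cong (suc n) λ i j → cong (M i) (toFront≗ j))) (∣det∣-swapAdjs n ks M)

-- Sums over subsets

-- subsetSum N m g w = Σ_{I ⊆ Fin N, |I| = m} g I · ∏_{i ∉ I} w i, with I listed increasingly as in `subsets`
subsetSum : (N m : ℕ) → (Vec (Fin N) m → ℕ) → (Fin N → ℕ) → ℕ
subsetSum zero    zero    g w = g []
subsetSum zero    (suc m) g w = 0
subsetSum (suc N) zero    g w = w zero * subsetSum N zero (g ∘ Vec.map suc) (tail w)
subsetSum (suc N) (suc m) g w =
  subsetSum N m (g ∘ (zero ∷_) ∘ Vec.map suc) (tail w) + w zero * subsetSum N (suc m) (g ∘ Vec.map suc) (tail w)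

Distinct : ∀ {N m} → Vec (Fin N) m → Set
Distinct I = Injective _≡_ _≡_ (lookup I)

Distinct-[] : ∀ {N} → Distinct {N} []
Distinct-[] {x = ()}

Distinct-map-suc : ∀ {N m} {J : Vec (Fin N) m} → Distinct J → Distinct (Vec.map suc J)
Distinct-map-suc {J = J} distinct {i} {j} eq =
  distinct (Fin.suc-injective (trans (sym (Vec.lookup-map i suc J)) (trans eq (Vec.lookup-map j suc J))))

Distinct-zero∷map-suc : ∀ {N m} {J : Vec (Fin N) m} → Distinct J → Distinct (zero ∷ Vec.map suc J)
Distinct-zero∷map-suc         distinct {zero}  {zero}  eq = refl
Distinct-zero∷map-suc {J = J} distinct {zero}  {suc j} eq with trans eq (Vec.lookup-map j suc J)
... | ()
Distinct-zero∷map-suc {J = J} distinct {suc i} {zero}  eq with trans (sym (Vec.lookup-map i suc J)) eq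
... | ()
Distinct-zero∷map-suc {J = J} distinct {suc i} {suc j} eq = cong suc (Distinct-map-suc {J = J} distinct eq)

subsetSum-cong : ∀ N m {g g′ : Vec (Fin N) m → ℕ} {w w′ : Fin N → ℕ} →
  (∀ I → Distinct I → g I ≡ g′ I) → (∀ i → w i ≡ w′ i) → subsetSum N m g w ≡ subsetSum N m g′ w′
subsetSum-cong zero    zero    g≗g′ w≗w′ = g≗g′ [] Distinct-[]
subsetSum-cong zero    (suc m) g≗g′ w≗w′ = refl
subsetSum-cong (suc N) zero    g≗g′ w≗w′ =
  cong₂ _*_ (w≗w′ zero) (subsetSum-cong N zero (λ I d → g≗g′ _ (Distinct-map-suc {J = I} d)) (w≗w′ ∘ suc))
subsetSum-cong (suc N) (suc m) g≗g′ w≗w′ =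
  cong₂ _+_ (subsetSum-cong N m (λ I d → g≗g′ _ (Distinct-zero∷map-suc {J = I} d)) (w≗w′ ∘ suc))
            (cong₂ _*_ (w≗w′ zero) (subsetSum-cong N (suc m) (λ I d → g≗g′ _ (Distinct-map-suc {J = I} d)) (w≗w′ ∘ suc)))

subsetSum-zero : ∀ N m (g : Vec (Fin N) m → ℕ) w → (∀ I → Distinct I → g I ≡ 0) → subsetSum N m g w ≡ 0
subsetSum-zero zero    zero    g w g≗0 = g≗0 [] Distinct-[]
subsetSum-zero zero    (suc m) g w g≗0 = refl
subsetSum-zero (suc N) zero    g w g≗0 =
  trans (cong (w zero *_) (subsetSum-zero N zero _ _ λ I d → g≗0 _ (Distinct-map-suc {J = I} d))) (ℕ.*-zeroʳ (w zero))
subsetSum-zero (suc N) (suc m) g w g≗0 =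
  cong₂ _+_ (subsetSum-zero N m _ _ λ I d → g≗0 _ (Distinct-zero∷map-suc {J = I} d))
            (trans (cong (w zero *_) (subsetSum-zero N (suc m) _ _ λ I d → g≗0 _ (Distinct-map-suc {J = I} d)))
                   (ℕ.*-zeroʳ (w zero)))

subsetSum-tooLarge : ∀ N m (g : Vec (Fin N) m → ℕ) w → N < m → subsetSum N m g w ≡ 0
subsetSum-tooLarge zero    (suc m) g w _         = refl
subsetSum-tooLarge (suc N) (suc m) g w (s≤s N<m) =
  cong₂ _+_ (subsetSum-tooLarge N m _ _ N<m)
            (trans (cong (w zero *_) (subsetSum-tooLarge N (suc m) _ _ (ℕ.m<n⇒m<1+n N<m))) (ℕ.*-zeroʳ (w zero)))

sumℕ-++ : ∀ xs ys → sumℕ (xs ++ ys) ≡ sumℕ xs + sumℕ ys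
sumℕ-++ []       ys = refl
sumℕ-++ (x ∷ xs) ys = trans (cong (x +_) (sumℕ-++ xs ys)) (sym (ℕ.+-assoc x (sumℕ xs) (sumℕ ys)))

sumℕ-map-subsets : ∀ N m (g : Vec (Fin N) m → ℕ) → sumℕ (map g (subsets m N)) ≡ subsetSum N m g (λ _ → 1)
sumℕ-map-subsets zero    zero    g = ℕ.+-identityʳ (g [])
sumℕ-map-subsets zero    (suc m) g = refl
sumℕ-map-subsets (suc N) zero    g = trans (sumℕ-map-subsets N zero (g ∘ Vec.map suc)) (sym (ℕ.+-identityʳ _))
sumℕ-map-subsets (suc N) (suc m) g = begin
  sumℕ (map g (map (λ v → zero ∷ Vec.map suc v) (subsets m N) ++ map (Vec.map suc) (subsets (suc m) N)))
    ≡⟨ cong sumℕ (List.map-++ g (map (λ v → zero ∷ Vec.map suc v) (subsets m N)) (map (Vec.map suc) (subsets (suc m) N))) ⟩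
  sumℕ (map g (map (λ v → zero ∷ Vec.map suc v) (subsets m N)) ++ map g (map (Vec.map suc) (subsets (suc m) N)))
    ≡⟨ sumℕ-++ (map g (map (λ v → zero ∷ Vec.map suc v) (subsets m N))) (map g (map (Vec.map suc) (subsets (suc m) N))) ⟩
  sumℕ (map g (map (λ v → zero ∷ Vec.map suc v) (subsets m N))) + sumℕ (map g (map (Vec.map suc) (subsets (suc m) N)))
    ≡⟨ cong₂ _+_ (cong sumℕ (sym (List.map-∘ (subsets m N)))) (cong sumℕ (sym (List.map-∘ (subsets (suc m) N)))) ⟩
  sumℕ (map (g ∘ (zero ∷_) ∘ Vec.map suc) (subsets m N)) + sumℕ (map (g ∘ Vec.map suc) (subsets (suc m) N))
    ≡⟨ cong₂ _+_ (sumℕ-map-subsets N m _) (trans (sumℕ-map-subsets N (suc m) _) (sym (ℕ.+-identityʳ _))) ⟩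
  subsetSum (suc N) (suc m) g (λ _ → 1) ∎
  where open ≡-Reasoning

indexOf : ∀ {N k} → Fin N → Vec (Fin N) k → Maybe (Fin k)
indexOf a []      = nothing
indexOf a (x ∷ I) = if does (a ≟ x) then just zero else Maybe.map suc (indexOf a I)

indexOf-just : ∀ {N k} (a : Fin N) (I : Vec (Fin N) k) {r} → indexOf a I ≡ just r → lookup I r ≡ a
indexOf-just a (x ∷ I) eq with a ≟ x | indexOf a I in eqI
indexOf-just a (x ∷ I) refl | yes a≡x | _      = sym a≡x
indexOf-just a (x ∷ I) refl | no _    | just r = indexOf-just a I eqI

indexOf-nothing : ∀ {N k} (a : Fin N) (I : Vec (Fin N) k) → indexOf a I ≡ nothing → ∀ i → lookup I i ≢ a
indexOf-nothing a (x ∷ I) eq i with a ≟ x | indexOf a I in eqI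
indexOf-nothing a (x ∷ I) () i       | yes _   | _
indexOf-nothing a (x ∷ I) eq zero    | no a≢x  | nothing = a≢x ∘ sym
indexOf-nothing a (x ∷ I) eq (suc i) | no _    | nothing = indexOf-nothing a I eqI i

indexOf-zero-map-suc : ∀ {N k} (J : Vec (Fin N) k) → indexOf zero (Vec.map suc J) ≡ nothing
indexOf-zero-map-suc []      = refl
indexOf-zero-map-suc (x ∷ J) rewrite indexOf-zero-map-suc J = refl

indexOf-suc-map-suc : ∀ {N k} (a : Fin N) (J : Vec (Fin N) k) → indexOf (suc a) (Vec.map suc J) ≡ indexOf a J
indexOf-suc-map-suc a []      = refl
indexOf-suc-map-suc a (x ∷ J) rewrite indexOf-suc-map-suc a J = refl

deleteAt : ∀ {A : Set} {k} → Vec A (suc k) → Fin (suc k) → Vec A k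
deleteAt I r = Vec.tabulate (lookup I ∘ punchIn r)

deleteAt-map : ∀ {A B : Set} {k} (f : A → B) (I : Vec A (suc k)) r → deleteAt (Vec.map f I) r ≡ Vec.map f (deleteAt I r)
deleteAt-map f I r = trans (Vec.tabulate-cong λ i → Vec.lookup-map (punchIn r i) f I) (Vec.tabulate-∘ f (lookup I ∘ punchIn r))

omit : ∀ {N m} → Fin N → (Vec (Fin N) m → ℕ) → Vec (Fin N) (suc m) → ℕ
omit a g I = Maybe.maybe′ (g ∘ deleteAt I) 0 (indexOf a I)

omit-zero-zero∷ : ∀ {N m} (g : Vec (Fin (suc N)) m → ℕ) J → omit zero g (zero ∷ Vec.map suc J) ≡ g (Vec.map suc J)
omit-zero-zero∷ g J = cong g (Vec.tabulate∘lookup (Vec.map suc J))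

omit-zero-map-suc : ∀ {N m} (g : Vec (Fin (suc N)) m → ℕ) J → omit zero g (Vec.map suc J) ≡ 0
omit-zero-map-suc g J rewrite indexOf-zero-map-suc J = refl

omit-suc-map-suc : ∀ {N m} a (g : Vec (Fin (suc N)) m → ℕ) J → omit (suc a) g (Vec.map suc J) ≡ omit a (g ∘ Vec.map suc) J
omit-suc-map-suc a g J rewrite indexOf-suc-map-suc a J with indexOf a J
... | nothing = refl
... | just r  = cong g (deleteAt-map suc J r)

omit-suc-zero∷ : ∀ {N m} a (g : Vec (Fin (suc N)) (suc m) → ℕ) J →
  omit (suc a) g (zero ∷ Vec.map suc J) ≡ omit a (g ∘ (zero ∷_) ∘ Vec.map suc) J
omit-suc-zero∷ a g J rewrite indexOf-suc-map-suc a J with indexOf a J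
... | nothing = refl
... | just r  = cong (g ∘ (zero ∷_)) (deleteAt-map suc J r)

subsetSum-updateAt : ∀ N m (a : Fin N) g w x →
  subsetSum N m g (updateAt w a (const x)) ≡ subsetSum N m g (updateAt w a (const 0)) + x * subsetSum N (suc m) (omit a g) w
subsetSum-updateAt (suc N) zero zero g w x = begin
  x * A                             ≡⟨ regroup x A (w zero) ⟩
  0 * A + x * (A + w zero * 0)      ≡⟨ cong₂ (λ p q → 0 * A + x * (p + w zero * q))
                                         (sym (subsetSum-cong N zero (λ J _ → omit-zero-zero∷ g J) λ _ → refl))
                                         (sym (subsetSum-zero N 1 _ _ λ J _ → omit-zero-map-suc g J)) ⟩
  0 * A + x * subsetSum (suc N) 1 (omit zero g) w ∎
  where
  open ≡-Reasoning
  A : ℕ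
  A = subsetSum N zero (g ∘ Vec.map suc) (tail w)
  regroup : ∀ x A w₀ → x * A ≡ 0 * A + x * (A + w₀ * 0)
  regroup = ℕ-solve-∀
subsetSum-updateAt (suc N) (suc m) zero g w x = begin
  A + x * B                              ≡⟨ regroup A B x (w zero) ⟩
  (A + 0 * B) + x * (B + w zero * 0)     ≡⟨ cong₂ (λ p q → (A + 0 * B) + x * (p + w zero * q))
                                              (sym (subsetSum-cong N (suc m) (λ J _ → omit-zero-zero∷ g J) λ _ → refl))
                                              (sym (subsetSum-zero N (suc (suc m)) _ _ λ J _ → omit-zero-map-suc g J)) ⟩
  (A + 0 * B) + x * subsetSum (suc N) (suc (suc m)) (omit zero g) w ∎
  where
  open ≡-Reasoning
  A B : ℕ
  A = subsetSum N m (g ∘ (zero ∷_) ∘ Vec.map suc) (tail w)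
  B = subsetSum N (suc m) (g ∘ Vec.map suc) (tail w)
  regroup : ∀ A B x w₀ → A + x * B ≡ (A + 0 * B) + x * (B + w₀ * 0)
  regroup = ℕ-solve-∀
subsetSum-updateAt (suc N) zero (suc a) g w x = begin
  w zero * subsetSum N zero (g ∘ Vec.map suc) (updateAt (tail w) a (const x))
    ≡⟨ cong (w zero *_) (subsetSum-updateAt N zero a (g ∘ Vec.map suc) (tail w) x) ⟩
  w zero * (A + x * B)                   ≡⟨ regroup (w zero) A x B ⟩
  w zero * A + x * (0 + w zero * B)      ≡⟨ cong₂ (λ p q → w zero * A + x * (p + w zero * q))
                                              (sym (subsetSum-zero N zero _ _ λ { [] _ → refl }))
                                              (sym (subsetSum-cong N 1 (λ J _ → omit-suc-map-suc a g J) λ _ → refl)) ⟩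
  w zero * A + x * subsetSum (suc N) 1 (omit (suc a) g) w ∎
  where
  open ≡-Reasoning
  A B : ℕ
  A = subsetSum N zero (g ∘ Vec.map suc) (updateAt (tail w) a (const 0))
  B = subsetSum N 1 (omit a (g ∘ Vec.map suc)) (tail w)
  regroup : ∀ w₀ A x B → w₀ * (A + x * B) ≡ w₀ * A + x * (0 + w₀ * B)
  regroup = ℕ-solve-∀
subsetSum-updateAt (suc N) (suc m) (suc a) g w x = begin
  subsetSum N m g₀ (updateAt (tail w) a (const x)) + w zero * subsetSum N (suc m) g₁ (updateAt (tail w) a (const x))
    ≡⟨ cong₂ (λ p q → p + w zero * q) (subsetSum-updateAt N m a g₀ (tail w) x) (subsetSum-updateAt N (suc m) a g₁ (tail w) x) ⟩
  (A + x * B) + w zero * (C + x * D)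
    ≡⟨ regroup A x B (w zero) C D ⟩
  (A + w zero * C) + x * (B + w zero * D)
    ≡⟨ cong₂ (λ p q → (A + w zero * C) + x * (p + w zero * q))
             (sym (subsetSum-cong N (suc m) (λ J _ → omit-suc-zero∷ a g J) λ _ → refl))
             (sym (subsetSum-cong N (suc (suc m)) (λ J _ → omit-suc-map-suc a g J) λ _ → refl)) ⟩
  (A + w zero * C) + x * subsetSum (suc N) (suc (suc m)) (omit (suc a) g) w ∎
  where
  open ≡-Reasoning
  g₀ : Vec (Fin N) m → ℕ
  g₀ = g ∘ (zero ∷_) ∘ Vec.map suc
  g₁ : Vec (Fin N) (suc m) → ℕ
  g₁ = g ∘ Vec.map suc
  A B C D : ℕ
  A = subsetSum N m g₀ (updateAt (tail w) a (const 0))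
  B = subsetSum N (suc m) (omit a g₀) (tail w)
  C = subsetSum N (suc m) g₁ (updateAt (tail w) a (const 0))
  D = subsetSum N (suc (suc m)) (omit a g₁) (tail w)
  regroup : ∀ A x B w₀ C D → (A + x * B) + w₀ * (C + x * D) ≡ (A + w₀ * C) + x * (B + w₀ * D)
  regroup = ℕ-solve-∀

-- AM-GM

^-distribʳ-* : ∀ x y n → (x * y) ^ n ≡ x ^ n * y ^ n
^-distribʳ-* x y zero    = refl
^-distribʳ-* x y (suc n) rewrite ^-distribʳ-* x y n = regroup x y (x ^ n) (y ^ n)
  where
  regroup : ∀ x y a b → x * y * (a * b) ≡ x * a * (y * b)
  regroup = ℕ-solve-∀

n^n>0 : ∀ n → 0 < n ^ n
n^n>0 zero    = s≤s z≤n
n^n>0 (suc n) = ℕ.m^n>0 (suc n) (suc n)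

2pq≤p²+q² : ∀ p q → p * q + p * q ≤ p * p + q * q
2pq≤p²+q² zero    q       = z≤n
2pq≤p²+q² (suc p) zero    rewrite ℕ.*-zeroʳ p = z≤n
2pq≤p²+q² (suc p) (suc q) = begin
  suc p * suc q + suc p * suc q           ≡⟨ expand p q ⟩
  (p * q + p * q) + 2 * (1 + p + q)       ≤⟨ ℕ.+-monoˡ-≤ (2 * (1 + p + q)) (2pq≤p²+q² p q) ⟩
  (p * p + q * q) + 2 * (1 + p + q)       ≡⟨ expand′ p q ⟩
  suc p * suc p + suc q * suc q           ∎
  where
  open ℕ.≤-Reasoning
  expand : ∀ p q → suc p * suc q + suc p * suc q ≡ (p * q + p * q) + 2 * (1 + p + q)
  expand = ℕ-solve-∀
  expand′ : ∀ p q → (p * p + q * q) + 2 * (1 + p + q) ≡ suc p * suc p + suc q * suc q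
  expand′ = ℕ-solve-∀

amgm-one-many : ∀ n p q → suc n * p * q ^ n ≤ p ^ suc n + n * q ^ suc n
amgm-one-many zero    p q = ℕ.≤-reflexive (regroup p q)
  where
  regroup : ∀ p q → 1 * p * 1 ≡ p * 1 + 0 * (q * 1)
  regroup = ℕ-solve-∀
amgm-one-many (suc n) p q = ℕ.+-cancelʳ-≤ (n * p * (q * X)) _ _ (begin
  suc (suc n) * p * (q * X) + n * p * (q * X)       ≡⟨ collect n p q X ⟩
  suc n * X * (p * q + p * q)                       ≤⟨ ℕ.*-monoʳ-≤ (suc n * X) (2pq≤p²+q² p q) ⟩
  suc n * X * (p * p + q * q)                       ≡⟨ distribute n p q X ⟩
  p * (suc n * p * X) + suc n * (q * (q * X))       ≤⟨ ℕ.+-monoˡ-≤ _ (ℕ.*-monoʳ-≤ p (amgm-one-many n p q)) ⟩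
  p * (p ^ suc n + n * (q * X)) + suc n * (q * (q * X)) ≡⟨ rearrange n p q X (p ^ suc n) ⟩
  (p * p ^ suc n + suc n * (q * (q * X))) + n * p * (q * X) ∎)
  where
  open ℕ.≤-Reasoning
  X : ℕ
  X = q ^ n
  collect : ∀ n p q X → suc (suc n) * p * (q * X) + n * p * (q * X) ≡ suc n * X * (p * q + p * q)
  collect = ℕ-solve-∀
  distribute : ∀ n p q X → suc n * X * (p * p + q * q) ≡ p * (suc n * p * X) + suc n * (q * (q * X))
  distribute = ℕ-solve-∀
  rearrange : ∀ n p q X Y → p * (Y + n * (q * X)) + suc n * (q * (q * X)) ≡ (p * Y + suc n * (q * (q * X))) + n * p * (q * X)
  rearrange = ℕ-solve-∀

-- AM-GM for a and m copies of b / m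
amgm-split : ∀ m a b → a * b ^ m * suc m ^ suc m ≤ (a + b) ^ suc m * m ^ m
amgm-split zero a b = begin
  a * 1 * (1 * 1)       ≡⟨ ℕ.*-identityʳ (a * 1) ⟩
  a * 1                 ≡⟨ ℕ.*-identityʳ a ⟩
  a                     ≤⟨ ℕ.m≤m+n a b ⟩
  a + b                 ≡⟨ sym (trans (ℕ.*-identityʳ ((a + b) * 1)) (ℕ.*-identityʳ (a + b))) ⟩
  (a + b) * 1 * 1       ∎
  where open ℕ.≤-Reasoning
amgm-split (suc m′) a b = ℕ.*-cancelˡ-≤ m (begin
  m * (a * b ^ m * suc m ^ suc m)   ≡⟨ regroup ⟩
  q ^ m * m * suc m * a             ≤⟨ key ⟩
  p ^ suc m                         ≡⟨ trans (^-distribʳ-* (a + b) m (suc m)) (swap-factor ((a + b) ^ suc m) m (m ^ m)) ⟩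
  m * ((a + b) ^ suc m * m ^ m)     ∎)
  where
  open ℕ.≤-Reasoning
  m p q : ℕ
  m = suc m′
  p = (a + b) * m
  q = suc m * b
  swap-factor : ∀ T m M → T * (m * M) ≡ m * (T * M)
  swap-factor = ℕ-solve-∀
  collect : ∀ m a b Q → Q * m * suc m * a + m * ((suc m * b) * Q) ≡ suc m * ((a + b) * m) * Q
  collect = ℕ-solve-∀
  rearrange : ∀ m a B S → m * (a * B * (suc m * S)) ≡ S * B * m * suc m * a
  rearrange = ℕ-solve-∀
  key : q ^ m * m * suc m * a ≤ p ^ suc m
  key = ℕ.+-cancelʳ-≤ (m * (q * q ^ m)) _ _ (begin
    q ^ m * m * suc m * a + m * (q * q ^ m)   ≡⟨ collect m a b (q ^ m) ⟩
    suc m * p * q ^ m                         ≤⟨ amgm-one-many m p q ⟩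
    p ^ suc m + m * (q * q ^ m)               ∎)
  regroup : m * (a * b ^ m * suc m ^ suc m) ≡ q ^ m * m * suc m * a
  regroup = trans (rearrange m a (b ^ m) (suc m ^ m))
                  (cong (λ x → x * m * suc m * a) (sym (^-distribʳ-* (suc m) b m)))

amgm-step : ∀ k w₀ W S → W * k ^ k ≤ S ^ k → w₀ * W * suc k ^ suc k ≤ (w₀ + S) ^ suc k
amgm-step k w₀ W S bound = ℕ.*-cancelʳ-≤ _ _ (k ^ k) {{>-nonZero (n^n>0 k)}} (begin
  w₀ * W * suc k ^ suc k * k ^ k      ≡⟨ regroup w₀ W (suc k ^ suc k) (k ^ k) ⟩
  w₀ * (W * k ^ k) * suc k ^ suc k    ≤⟨ ℕ.*-monoˡ-≤ (suc k ^ suc k) (ℕ.*-monoʳ-≤ w₀ bound) ⟩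
  w₀ * S ^ k * suc k ^ suc k          ≤⟨ amgm-split k w₀ S ⟩
  (w₀ + S) ^ suc k * k ^ k            ∎)
  where
  open ℕ.≤-Reasoning
  regroup : ∀ w₀ W P K → w₀ * W * P * K ≡ w₀ * (W * K) * P
  regroup = ℕ-solve-∀

-- Weighted wedge norms

weightedWedge : (N L : ℕ) → (Fin L → Fin N → ℤ) → (Fin N → ℕ) → ℕ
weightedWedge N L ξ = subsetSum N L (λ I → ∣ det L (subMatrix ξ I) ∣)

wedgeNorm1≡weightedWedge : ∀ N L ξ → wedgeNorm1 N L ξ ≡ weightedWedge N L ξ (λ _ → 1)
wedgeNorm1≡weightedWedge N L ξ = sumℕ-map-subsets N L (λ I → ∣ det L (subMatrix ξ I) ∣)

weightedWedge-cong : ∀ N L (ξ ξ′ : Fin L → Fin N → ℤ) → (∀ ℓ i → ξ ℓ i ≡ ξ′ ℓ i) →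
  ∀ w → weightedWedge N L ξ w ≡ weightedWedge N L ξ′ w
weightedWedge-cong N L ξ ξ′ ξ≗ξ′ w =
  subsetSum-cong N L (λ I _ → cong ∣_∣ (det-cong L λ r ℓ → ξ≗ξ′ ℓ (lookup I r))) λ _ → refl

weightedWedge-zeroColumn : ∀ N L (ξ : Fin (suc L) → Fin N → ℤ) w j → (∀ i → ξ j i ≡ 0ℤ) → weightedWedge N (suc L) ξ w ≡ 0
weightedWedge-zeroColumn N L ξ w j ξj≡0 =
  subsetSum-zero N (suc L) _ w λ I _ → cong ∣_∣ (det-zeroColumn L (subMatrix ξ I) j (ξj≡0 ∘ lookup I))

weightedWedge-toFront : ∀ N L (ξ : Fin (suc L) → Fin N → ℤ) w k →
  weightedWedge N (suc L) (ξ ∘ toFront k) w ≡ weightedWedge N (suc L) ξ w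
weightedWedge-toFront N L ξ w k = subsetSum-cong N (suc L) (λ I _ → ∣det∣-toFront L k (subMatrix ξ I)) λ _ → refl

weightedWedge-addColumn₁To₀ : ∀ N L (ξ ξ′ : Fin (suc (suc L)) → Fin N → ℤ) w t →
  (∀ i → ξ′ zero i ≡ ξ zero i ℤ.+ t ℤ.* ξ (suc zero) i) → (∀ l i → ξ′ (suc l) i ≡ ξ (suc l) i) →
  weightedWedge N (suc (suc L)) ξ′ w ≡ weightedWedge N (suc (suc L)) ξ w
weightedWedge-addColumn₁To₀ N L ξ ξ′ w t ξ′₀≡ ξ′ₛ≡ = subsetSum-cong N (suc (suc L)) minors≡ λ _ → refl
  where
  minors≡ : ∀ I → Distinct I → ∣ det (suc (suc L)) (subMatrix ξ′ I) ∣ ≡ ∣ det (suc (suc L)) (subMatrix ξ I) ∣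
  minors≡ I _ = cong ∣_∣ (trans (det-cong (suc (suc L)) {subMatrix ξ′ I} {withColumn₀ (subMatrix ξ I) column₀} columns≡)
                                (det-addColumn₁To₀ L (subMatrix ξ I) t))
    where
    column₀ : Fin (suc (suc L)) → ℤ
    column₀ r = ξ zero (lookup I r) ℤ.+ t ℤ.* ξ (suc zero) (lookup I r)
    columns≡ : ∀ r l → subMatrix ξ′ I r l ≡ withColumn₀ (subMatrix ξ I) column₀ r l
    columns≡ r zero    = ξ′₀≡ (lookup I r)
    columns≡ r (suc l) = ξ′ₛ≡ l (lookup I r)

-- the part of weightedWedge (suc N) (suc L) ξ coming from the subsets containing row 0
weightedWedge₀ : ∀ N L → (Fin (suc L) → Fin (suc N) → ℤ) → (Fin N → ℕ) → ℕ
weightedWedge₀ N L ξ = subsetSum N L (λ J → ∣ det (suc L) (subMatrix ξ (zero ∷ Vec.map suc J)) ∣)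

weightedWedge-split : ∀ N L (ξ : Fin (suc L) → Fin (suc N) → ℤ) w →
  weightedWedge (suc N) (suc L) ξ w ≡ weightedWedge₀ N L ξ (tail w) + w zero * weightedWedge N (suc L) (tail ∘ ξ) (tail w)
weightedWedge-split N L ξ w = cong (λ x → weightedWedge₀ N L ξ (tail w) + w zero * x)
  (subsetSum-cong N (suc L) (λ J _ → cong ∣_∣ (det-cong (suc L) λ r ℓ → cong (ξ ℓ) (Vec.lookup-map r suc J))) λ _ → refl)

weightedWedge₀-zeroRow : ∀ N L (ξ : Fin (suc L) → Fin (suc N) → ℤ) w → (∀ ℓ → ξ ℓ zero ≡ 0ℤ) →
  weightedWedge₀ N L ξ w ≡ 0
weightedWedge₀-zeroRow N L ξ w row₀≡0 = subsetSum-zero N L _ w λ J _ → cong ∣_∣ (alt-sum-zero (suc L) (term≡0 J))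
  where
  term≡0 : ∀ J ℓ → ξ ℓ zero ℤ.* det L (minor (subMatrix ξ (zero ∷ Vec.map suc J)) ℓ) ≡ 0ℤ
  term≡0 J ℓ = trans (cong (ℤ._* d) (row₀≡0 ℓ)) (ℤ.*-zeroˡ d)
    where
    d : ℤ
    d = det L (minor (subMatrix ξ (zero ∷ Vec.map suc J)) ℓ)

weightedWedge₀-unitRow : ∀ N L (ξ : Fin (suc L) → Fin (suc N) → ℤ) w j → ∣ ξ j zero ∣ ≡ 1 →
  (∀ ℓ → ℓ ≢ j → ξ ℓ zero ≡ 0ℤ) → weightedWedge₀ N L ξ w ≡ weightedWedge N L (λ ℓ → tail (ξ (punchIn j ℓ))) w
weightedWedge₀-unitRow N L ξ w j ∣ξj₀∣≡1 row₀≡0 = subsetSum-cong N L minors≡ λ _ → refl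
  where
  minors≡ : ∀ J → Distinct J → ∣ det (suc L) (subMatrix ξ (zero ∷ Vec.map suc J)) ∣ ≡
                               ∣ det L (subMatrix (λ ℓ → tail (ξ (punchIn j ℓ))) J) ∣
  minors≡ J _ = begin
    ∣ det (suc L) M ∣                             ≡⟨ cong ∣_∣ (alt-sum-single (suc L) _ j term≡0) ⟩
    ∣ sign j ℤ.* (ξ j zero ℤ.* det L (minor M j)) ∣ ≡⟨ ∣sign*unit*x∣≡∣x∣ j (ξ j zero) (det L (minor M j)) ∣ξj₀∣≡1 ⟩
    ∣ det L (minor M j) ∣                         ≡⟨ cong ∣_∣ (det-cong L λ r ℓ → cong (ξ (punchIn j ℓ)) (Vec.lookup-map r suc J)) ⟩
    ∣ det L (subMatrix (λ ℓ → tail (ξ (punchIn j ℓ))) J) ∣ ∎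
    where
    open ≡-Reasoning
    M : Matrix (suc L)
    M = subMatrix ξ (zero ∷ Vec.map suc J)
    term≡0 : ∀ ℓ → ℓ ≢ j → ξ ℓ zero ℤ.* det L (minor M ℓ) ≡ 0ℤ
    term≡0 ℓ ℓ≢j = trans (cong (ℤ._* det L (minor M ℓ)) (row₀≡0 ℓ ℓ≢j)) (ℤ.*-zeroˡ (det L (minor M ℓ)))

weightedWedge-zeroRow : ∀ N L (ξ : Fin (suc L) → Fin (suc N) → ℤ) w → (∀ ℓ → ξ ℓ zero ≡ 0ℤ) →
  weightedWedge (suc N) (suc L) ξ w ≡ w zero * weightedWedge N (suc L) (tail ∘ ξ) (tail w)
weightedWedge-zeroRow N L ξ w row₀≡0 =
  trans (weightedWedge-split N L ξ w) (cong (_+ w zero * weightedWedge N (suc L) (tail ∘ ξ) (tail w))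
                                            (weightedWedge₀-zeroRow N L ξ (tail w) row₀≡0))

weightedWedge-unitRow : ∀ N L (ξ : Fin (suc L) → Fin (suc N) → ℤ) w j → ∣ ξ j zero ∣ ≡ 1 →
  (∀ ℓ → ℓ ≢ j → ξ ℓ zero ≡ 0ℤ) →
  let η = λ ℓ → tail (ξ (punchIn j ℓ)) in
  weightedWedge (suc N) (suc L) ξ w ≡
  weightedWedge N L η (tail w) + w zero * weightedWedge N (suc L) (tail (ξ j) Vector.∷ η) (tail w)
weightedWedge-unitRow N L ξ w j ∣ξj₀∣≡1 row₀≡0 =
  trans (weightedWedge-split N L ξ w)
        (cong₂ (λ x y → x + w zero * y) (weightedWedge₀-unitRow N L ξ (tail w) j ∣ξj₀∣≡1 row₀≡0) toFront-j)
  where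
  toFront-j : weightedWedge N (suc L) (tail ∘ ξ) (tail w) ≡
              weightedWedge N (suc L) (tail (ξ j) Vector.∷ (λ ℓ → tail (ξ (punchIn j ℓ)))) (tail w)
  toFront-j = trans (sym (weightedWedge-toFront N L (tail ∘ ξ) (tail w) j))
                    (weightedWedge-cong N (suc L) (tail ∘ ξ ∘ toFront j) (tail (ξ j) Vector.∷ (λ ℓ → tail (ξ (punchIn j ℓ))))
                                          (λ { zero i → refl ; (suc ℓ) i → refl }) (tail w))

e-diagonal : ∀ {N} (a : Fin N) → e a a ≡ 1ℤ
e-diagonal zero    = refl
e-diagonal (suc a) = e-diagonal a

e-offDiagonal : ∀ {N} (a b : Fin N) → a ≢ b → e a b ≡ 0ℤ
e-offDiagonal zero    zero    a≢b = contradiction refl a≢b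
e-offDiagonal zero    (suc b) _   = refl
e-offDiagonal (suc a) zero    _   = refl
e-offDiagonal (suc a) (suc b) a≢b = e-offDiagonal a b (a≢b ∘ cong suc)

weightedWedge-updateAt : ∀ N m (η : Fin m → Fin N → ℤ) (c : Fin N → ℤ) a u → ∣ u ∣ ≡ 1 →
  (∀ i → c i ≡ u ℤ.* e a i) →
  ∀ w x → weightedWedge N m η (updateAt w a (const x)) ≡
          weightedWedge N m η (updateAt w a (const 0)) + x * weightedWedge N (suc m) (c Vector.∷ η) w
weightedWedge-updateAt N m η c a u ∣u∣≡1 c≡ue w x =
  trans (subsetSum-updateAt N m a g w x)
        (cong (λ y → weightedWedge N m η (updateAt w a (const 0)) + x * y) (subsetSum-cong N (suc m) omit≡ λ _ → refl))
  where
  g : Vec (Fin N) m → ℕ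
  g I = ∣ det m (subMatrix η I) ∣
  c≡0 : ∀ i → a ≢ i → c i ≡ 0ℤ
  c≡0 i a≢i = trans (c≡ue i) (trans (cong (u ℤ.*_) (e-offDiagonal a i a≢i)) (ℤ.*-zeroʳ u))
  omit≡ : ∀ I → Distinct I → omit a g I ≡ ∣ det (suc m) (subMatrix (c Vector.∷ η) I) ∣
  omit≡ I distinct with indexOf a I in eq
  ... | nothing = sym (cong ∣_∣ (det-zeroColumn m (subMatrix (c Vector.∷ η) I) zero λ r →
                    c≡0 (lookup I r) λ a≡Ir → indexOf-nothing a I eq r (sym a≡Ir)))
  ... | just r  = sym (begin
    ∣ det (suc m) (subMatrix (c Vector.∷ η) I) ∣
      ≡⟨ cong ∣_∣ (det-unitColumn₀ m (subMatrix (c Vector.∷ η) I) r u column₀-r column₀-others) ⟩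
    ∣ sign r ℤ.* (u ℤ.* det m (λ i k → η k (lookup I (punchIn r i)))) ∣
      ≡⟨ ∣sign*unit*x∣≡∣x∣ r u _ ∣u∣≡1 ⟩
    ∣ det m (λ i k → η k (lookup I (punchIn r i))) ∣
      ≡⟨ cong ∣_∣ (det-cong m λ i k → cong (η k) (sym (Vec.lookup∘tabulate (lookup I ∘ punchIn r) i))) ⟩
    g (deleteAt I r) ∎)
    where
    open ≡-Reasoning
    Ir≡a : lookup I r ≡ a
    Ir≡a = indexOf-just a I eq
    column₀-r : c (lookup I r) ≡ u
    column₀-r = trans (c≡ue (lookup I r)) (trans (cong (λ i → u ℤ.* e a i) Ir≡a)
                                                 (trans (cong (u ℤ.*_) (e-diagonal a)) (ℤ.*-identityʳ u)))
    column₀-others : ∀ i → i ≢ r → c (lookup I i) ≡ 0ℤ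
    column₀-others i i≢r = c≡0 (lookup I i) λ a≡Ii → i≢r (distinct (trans (sym a≡Ii) (sym Ir≡a)))

weightedWedge-absorb : ∀ N L (η : Fin L → Fin N → ℤ) c a u → ∣ u ∣ ≡ 1 → (∀ i → c i ≡ u ℤ.* e a i) → ∀ w y →
  weightedWedge N L η w + y * weightedWedge N (suc L) (c Vector.∷ η) w ≡
  weightedWedge N L η (updateAt w a (const (w a + y)))
weightedWedge-absorb N L η c a u ∣u∣≡1 c≡ue w y = begin
  weightedWedge N L η w + y * D
    ≡⟨ cong (λ x → x + y * D) (trans (subsetSum-cong N L (λ _ _ → refl) λ i → sym (updateAt-id-local a w refl i))
                                     (weightedWedge-updateAt N L η c a u ∣u∣≡1 c≡ue w (w a))) ⟩
  (C + w a * D) + y * D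
    ≡⟨ trans (ℕ.+-assoc C (w a * D) (y * D)) (cong (C +_) (sym (ℕ.*-distribʳ-+ D (w a) y))) ⟩
  C + (w a + y) * D
    ≡⟨ sym (weightedWedge-updateAt N L η c a u ∣u∣≡1 c≡ue w (w a + y)) ⟩
  weightedWedge N L η (updateAt w a (const (w a + y))) ∎
  where
  open ≡-Reasoning
  C D : ℕ
  C = weightedWedge N L η (updateAt w a (const 0))
  D = weightedWedge N (suc L) (c Vector.∷ η) w

indicator : Bool → ℕ
indicator b = if b then 1 else 0

count : ∀ {L} → (Fin L → Bool) → ℕ
count {zero}  f = 0
count {suc L} f = indicator (f zero) + count (tail f)

count-punchIn : ∀ {L} (f : Fin (suc L) → Bool) k → count f ≡ indicator (f k) + count (f ∘ punchIn k)
count-punchIn f zero = refl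
count-punchIn {suc L} f (suc k) =
  trans (cong (indicator (f zero) +_) (count-punchIn (tail f) k))
        (exchange (indicator (f zero)) (indicator (f (suc k))) (count (tail f ∘ punchIn k)))
  where
  exchange : ∀ x y z → x + (y + z) ≡ y + (x + z)
  exchange = ℕ-solve-∀

count-toFront : ∀ {L} (f : Fin (suc L) → Bool) k → count (f ∘ toFront k) ≡ count f
count-toFront f k = sym (count-punchIn f k)

data Occurrences {L} (f : Fin (suc L) → Bool) : Set where
  none : (∀ ℓ → f ℓ ≡ false) → Occurrences f
  one  : ∀ j → f j ≡ true → (∀ c → f (punchIn j c) ≡ false) → Occurrences f
  two  : ∀ j c → f j ≡ true → f (punchIn j c) ≡ true → Occurrences f

occurrences : ∀ {L} (f : Fin (suc L) → Bool) → Occurrences f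
occurrences f with Fin.any? (λ ℓ → f ℓ Bool.≟ true)
... | no ∄ = none λ ℓ → Bool.¬-not (λ fℓ → ∄ (ℓ , fℓ))
... | yes (j , fj) with Fin.any? (λ c → f (punchIn j c) Bool.≟ true)
...   | no ∄  = one j fj λ c → Bool.¬-not (λ fc → ∄ (c , fc))
...   | yes (c , fc) = two j c fj fc

-- Graphs on the vertices Fin N plus a ground vertex `nothing`, whose unit vector is 0.
-- The vectors e_m - e_n of F_N are the incidence vectors of the edges avoiding the ground.
Vertex : ℕ → Set
Vertex N = Maybe (Fin N)

Edge : ℕ → Set
Edge N = Vertex N × Vertex N

unit : ∀ {N} → Vertex N → Fin N → ℤ
unit nothing  i = 0ℤ
unit (just m) i = e m i

incidence : ∀ {N} → Edge N → Fin N → ℤ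
incidence (p , q) i = unit p i ℤ.- unit q i

lift : ∀ {N} → Vertex N → Vertex (suc N)
lift = Maybe.map suc

contract : ∀ {N} → Vertex (suc N) → Vertex N
contract nothing        = nothing
contract (just zero)    = nothing
contract (just (suc m)) = just m

contractEdge : ∀ {N} → Edge (suc N) → Edge N
contractEdge (p , q) = contract p , contract q

unit-suc : ∀ {N} (p : Vertex (suc N)) i → unit p (suc i) ≡ unit (contract p) i
unit-suc nothing        i = refl
unit-suc (just zero)    i = refl
unit-suc (just (suc m)) i = refl

incidence-suc : ∀ {N} (E : Edge (suc N)) i → incidence E (suc i) ≡ incidence (contractEdge E) i
incidence-suc (p , q) i = cong₂ ℤ._-_ (unit-suc p i) (unit-suc q i)

orient : ∀ {N} → Sign → Edge N → Edge N
orient Sign.+ E = E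
orient Sign.- E = swap E

incidence-orient : ∀ {N} s (E : Edge N) i → incidence (orient s E) i ≡ (s ◃ 1) ℤ.* incidence E i
incidence-orient Sign.+ (p , q) i = sym (ℤ.*-identityˡ _)
incidence-orient Sign.- (p , q) i = regroup (unit p i) (unit q i)
  where
  regroup : ∀ a b → b ℤ.- a ≡ -1ℤ ℤ.* (a ℤ.- b)
  regroup = solve-∀

star : ∀ {N} → Sign → Vertex N → Edge (suc N)
star s v = orient s (just zero , lift v)

isZero : ∀ {N} → Vertex (suc N) → Bool
isZero (just zero) = true
isZero _           = false

-- xor: a loop at 0 has incidence vector 0 and does not count as touching 0
touches₀ : ∀ {N} → Edge (suc N) → Bool
touches₀ (p , q) = isZero p xor isZero q

touches₀-false : ∀ {N} (E : Edge (suc N)) → touches₀ E ≡ false → incidence E zero ≡ 0ℤ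
touches₀-false (nothing        , nothing)        _ = refl
touches₀-false (nothing        , just (suc m))   _ = refl
touches₀-false (just zero      , just zero)      _ = refl
touches₀-false (just (suc m)   , nothing)        _ = refl
touches₀-false (just (suc m)   , just (suc m′))  _ = refl

touches₀-true : ∀ {N} (E : Edge (suc N)) → touches₀ E ≡ true → ∃ λ s → ∃ λ v → E ≡ star s v
touches₀-true (nothing        , just zero)    _ = Sign.- , nothing , refl
touches₀-true (just zero      , nothing)      _ = Sign.+ , nothing , refl
touches₀-true (just zero      , just (suc m)) _ = Sign.+ , just m , refl
touches₀-true (just (suc m)   , just zero)    _ = Sign.- , just m , refl

∣incidence-star₀∣≡1 : ∀ {N} s (v : Vertex N) → ∣ incidence (star s v) zero ∣ ≡ 1
∣incidence-star₀∣≡1 Sign.+ nothing  = refl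
∣incidence-star₀∣≡1 Sign.+ (just m) = refl
∣incidence-star₀∣≡1 Sign.- nothing  = refl
∣incidence-star₀∣≡1 Sign.- (just m) = refl

incidence-star-suc : ∀ {N} s (v : Vertex N) i → incidence (star s v) (suc i) ≡ (opposite s ◃ 1) ℤ.* unit v i
incidence-star-suc Sign.+ nothing  i = refl
incidence-star-suc Sign.+ (just m) i = regroup (e m i)
  where
  regroup : ∀ a → 0ℤ ℤ.- a ≡ -1ℤ ℤ.* a
  regroup = solve-∀
incidence-star-suc Sign.- nothing  i = refl
incidence-star-suc Sign.- (just m) i = regroup (e m i)
  where
  regroup : ∀ a → a ℤ.- 0ℤ ≡ 1ℤ ℤ.* a
  regroup = solve-∀

isZero-lift : ∀ {N} (v : Vertex N) → isZero (lift v) ≡ false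
isZero-lift nothing  = refl
isZero-lift (just m) = refl

touches₀-orient-lift : ∀ {N} s (a b : Vertex N) → touches₀ (orient s (lift a , lift b)) ≡ false
touches₀-orient-lift Sign.+ a b rewrite isZero-lift a | isZero-lift b = refl
touches₀-orient-lift Sign.- a b rewrite isZero-lift a | isZero-lift b = refl

-- eliminating the entry at 0 of one star edge by another yields the edge between their other ends
incidence-merge : ∀ {N} s₀ (v₀ : Vertex N) s₁ v₁ i →
  incidence (orient s₀ (lift v₁ , lift v₀)) i ≡
  incidence (star s₀ v₀) i ℤ.+ ℤ.- ((s₀ ◃ 1) ℤ.* (s₁ ◃ 1)) ℤ.* incidence (star s₁ v₁) i
incidence-merge s₀ v₀ s₁ v₁ i
  rewrite incidence-orient s₀ (lift v₁ , lift v₀) i | incidence-orient s₀ (just zero , lift v₀) i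
        | incidence-orient s₁ (just zero , lift v₁) i
  with s₁
... | Sign.+ = regroup (s₀ ◃ 1) (e zero i) (unit (lift v₀) i) (unit (lift v₁) i)
  where
  regroup : ∀ σ x a b → σ ℤ.* (b ℤ.- a) ≡ σ ℤ.* (x ℤ.- a) ℤ.+ ℤ.- (σ ℤ.* 1ℤ) ℤ.* (1ℤ ℤ.* (x ℤ.- b))
  regroup = solve-∀
... | Sign.- = regroup (s₀ ◃ 1) (e zero i) (unit (lift v₀) i) (unit (lift v₁) i)
  where
  regroup : ∀ σ x a b → σ ℤ.* (b ℤ.- a) ≡ σ ℤ.* (x ℤ.- a) ℤ.+ ℤ.- (σ ℤ.* -1ℤ) ℤ.* (-1ℤ ℤ.* (x ℤ.- b))
  regroup = solve-∀

weightedWedge-untouched : ∀ N L (G : Fin (suc L) → Edge (suc N)) w → (∀ ℓ → touches₀ (G ℓ) ≡ false) →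
  weightedWedge (suc N) (suc L) (incidence ∘ G) w ≡ w zero * weightedWedge N (suc L) (incidence ∘ contractEdge ∘ G) (tail w)
weightedWedge-untouched N L G w untouched =
  trans (weightedWedge-zeroRow N L (incidence ∘ G) w λ ℓ → touches₀-false (G ℓ) (untouched ℓ))
        (cong (w zero *_) (weightedWedge-cong N (suc L) (tail ∘ incidence ∘ G) (incidence ∘ contractEdge ∘ G)
                                                (λ ℓ → incidence-suc (G ℓ)) (tail w)))

weightedWedge-oneTouching : ∀ N L (G : Fin (suc L) → Edge (suc N)) w j s v → G j ≡ star s v →
  (∀ c → touches₀ (G (punchIn j c)) ≡ false) →
  let η = incidence ∘ contractEdge ∘ G ∘ punchIn j in
  weightedWedge (suc N) (suc L) (incidence ∘ G) w ≡
  weightedWedge N L η (tail w) + w zero * weightedWedge N (suc L) ((λ i → (opposite s ◃ 1) ℤ.* unit v i) Vector.∷ η) (tail w)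
weightedWedge-oneTouching N L G w j s v Gj≡ others = begin
  weightedWedge (suc N) (suc L) (incidence ∘ G) w
    ≡⟨ weightedWedge-unitRow N L (incidence ∘ G) w j ∣ξj₀∣≡1 row₀≡0 ⟩
  weightedWedge N L (λ ℓ → tail (incidence (G (punchIn j ℓ)))) (tail w) +
  w zero * weightedWedge N (suc L) (tail (incidence (G j)) Vector.∷ (λ ℓ → tail (incidence (G (punchIn j ℓ))))) (tail w)
    ≡⟨ cong₂ (λ x y → x + w zero * y)
             (weightedWedge-cong N L _ η (λ ℓ → incidence-suc (G (punchIn j ℓ))) (tail w))
             (weightedWedge-cong N (suc L) (tail (incidence (G j)) Vector.∷ (tail ∘ incidence ∘ G ∘ punchIn j)) (c Vector.∷ η)
                                 (λ { zero i → trans (cong (λ E → incidence E (suc i)) Gj≡) (incidence-star-suc s v i)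
                                    ; (suc ℓ) → incidence-suc (G (punchIn j ℓ)) })
                                 (tail w)) ⟩
  weightedWedge N L η (tail w) + w zero * weightedWedge N (suc L) (c Vector.∷ η) (tail w) ∎
  where
  open ≡-Reasoning
  η : Fin L → Fin N → ℤ
  η = incidence ∘ contractEdge ∘ G ∘ punchIn j
  c : Fin N → ℤ
  c = λ i → (opposite s ◃ 1) ℤ.* unit v i
  ∣ξj₀∣≡1 : ∣ incidence (G j) zero ∣ ≡ 1
  ∣ξj₀∣≡1 = trans (cong (λ E → ∣ incidence E zero ∣) Gj≡) (∣incidence-star₀∣≡1 s v)
  row₀≡0 : ∀ ℓ → ℓ ≢ j → incidence (G ℓ) zero ≡ 0ℤ
  row₀≡0 ℓ ℓ≢j = trans (cong (λ ℓ′ → incidence (G ℓ′) zero) (sym (Fin.punchIn-punchOut (ℓ≢j ∘ sym))))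
                       (touches₀-false (G (punchIn j (punchOut (ℓ≢j ∘ sym)))) (others (punchOut (ℓ≢j ∘ sym))))

mergeStars : ∀ {N L} (G : Fin (suc (suc L)) → Edge (suc N)) j c →
  touches₀ (G j) ≡ true → touches₀ (G (punchIn j c)) ≡ true →
  ∃ λ (G′ : Fin (suc (suc L)) → Edge (suc N)) →
    (∀ w → weightedWedge (suc N) (suc (suc L)) (incidence ∘ G) w ≡ weightedWedge (suc N) (suc (suc L)) (incidence ∘ G′) w) ×
    suc (count (touches₀ ∘ G′)) ≡ count (touches₀ ∘ G)
mergeStars {N} {L} G j c touches-j touches-jc
  with touches₀-true (G (punchIn j c)) touches-jc | touches₀-true (G j) touches-j
... | s₀ , v₀ , H₀≡ | s₁ , v₁ , H₁≡ = G′ , sameWedge , countDrops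
  where
  H : Fin (suc (suc L)) → Edge (suc N)
  H = G ∘ toFront j ∘ toFront (suc c)
  G′ : Fin (suc (suc L)) → Edge (suc N)
  G′ = orient s₀ (lift v₁ , lift v₀) Vector.∷ tail H
  t : ℤ
  t = ℤ.- ((s₀ ◃ 1) ℤ.* (s₁ ◃ 1))
  merged : ∀ i → incidence (G′ zero) i ≡ incidence (H zero) i ℤ.+ t ℤ.* incidence (H (suc zero)) i
  merged i rewrite H₀≡ | H₁≡ = incidence-merge s₀ v₀ s₁ v₁ i
  sameWedge : ∀ w → weightedWedge (suc N) (suc (suc L)) (incidence ∘ G) w ≡ weightedWedge (suc N) (suc (suc L)) (incidence ∘ G′) w
  sameWedge w = begin
    weightedWedge (suc N) (suc (suc L)) (incidence ∘ G) w
      ≡⟨ sym (weightedWedge-toFront (suc N) (suc L) (incidence ∘ G) w j) ⟩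
    weightedWedge (suc N) (suc (suc L)) (incidence ∘ G ∘ toFront j) w
      ≡⟨ sym (weightedWedge-toFront (suc N) (suc L) (incidence ∘ G ∘ toFront j) w (suc c)) ⟩
    weightedWedge (suc N) (suc (suc L)) (incidence ∘ H) w
      ≡⟨ sym (weightedWedge-addColumn₁To₀ (suc N) L (incidence ∘ H) (incidence ∘ G′) w t merged λ _ _ → refl) ⟩
    weightedWedge (suc N) (suc (suc L)) (incidence ∘ G′) w ∎
    where open ≡-Reasoning
  countDrops : suc (count (touches₀ ∘ G′)) ≡ count (touches₀ ∘ G)
  countDrops = begin
    suc (count (touches₀ ∘ G′))                 ≡⟨ cong (λ b → suc (indicator b + count (touches₀ ∘ tail H)))
                                                        (touches₀-orient-lift s₀ v₁ v₀) ⟩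
    indicator true + count (touches₀ ∘ tail H)  ≡⟨ cong (λ b → indicator b + count (touches₀ ∘ tail H)) (sym touches-jc) ⟩
    count (touches₀ ∘ H)                        ≡⟨ count-toFront (touches₀ ∘ G ∘ toFront j) (suc c) ⟩
    count (touches₀ ∘ G ∘ toFront j)            ≡⟨ count-toFront (touches₀ ∘ G) j ⟩
    count (touches₀ ∘ G)                        ∎
    where open ≡-Reasoning

-- The induction

sum-ones : ∀ N → sum {N} (λ _ → 1) ≡ N
sum-ones zero    = refl
sum-ones (suc N) = cong suc (sum-ones N)

sum-updateAt-+ : ∀ {N} (w : Fin N → ℕ) a y → sum (updateAt w a (const (w a + y))) ≡ sum w + y
sum-updateAt-+ w zero y = begin
  (w zero + y) + sum (tail w)  ≡⟨ ℕ.+-assoc (w zero) y (sum (tail w)) ⟩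
  w zero + (y + sum (tail w))  ≡⟨ cong (w zero +_) (ℕ.+-comm y (sum (tail w))) ⟩
  w zero + (sum (tail w) + y)  ≡⟨ sym (ℕ.+-assoc (w zero) (sum (tail w)) y) ⟩
  w zero + sum (tail w) + y    ∎
  where open ≡-Reasoning
sum-updateAt-+ w (suc a) y =
  trans (cong (w zero +_) (sum-updateAt-+ (tail w) a y)) (sym (ℕ.+-assoc (w zero) (sum (tail w)) y))

bound-mono : ∀ k {W W′ S S′} → W ≤ W′ → S′ ≤ S → W′ * k ^ k ≤ S′ ^ k → W * k ^ k ≤ S ^ k
bound-mono k W≤W′ S′≤S bound = ℕ.≤-trans (ℕ.*-monoˡ-≤ (k ^ k) W≤W′) (ℕ.≤-trans bound (ℕ.^-monoˡ-≤ k S′≤S))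

WedgeBound : (N L : ℕ) → (Fin L → Fin N → ℤ) → (Fin N → ℕ) → Set
WedgeBound N L ξ w = weightedWedge N L ξ w * (N ∸ L) ^ (N ∸ L) ≤ sum w ^ (N ∸ L)

GraphBound : ℕ → Set
GraphBound N = ∀ L (G : Fin L → Edge N) w → WedgeBound N L (incidence ∘ G) w

module _ (N : ℕ) (ih : GraphBound N) where

  bound-noEdges : ∀ (G : Fin 0 → Edge (suc N)) w → WedgeBound (suc N) 0 (incidence ∘ G) w
  bound-noEdges G w = amgm-step N (w zero) _ (sum (tail w)) (ih 0 (λ ()) (tail w))

  bound-untouched : ∀ L (G : Fin (suc L) → Edge (suc N)) w → (∀ ℓ → touches₀ (G ℓ) ≡ false) →
    WedgeBound (suc N) (suc L) (incidence ∘ G) w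
  bound-untouched L G w untouched with suc L ℕ.≤? N
  ... | no  L≥N = bound-mono (N ∸ L) (ℕ.≤-reflexive W≡0) ℕ.≤-refl z≤n
    where
    open ≡-Reasoning
    W′ : ℕ
    W′ = weightedWedge N (suc L) (incidence ∘ contractEdge ∘ G) (tail w)
    W≡0 : weightedWedge (suc N) (suc L) (incidence ∘ G) w ≡ 0
    W≡0 = begin
      weightedWedge (suc N) (suc L) (incidence ∘ G) w  ≡⟨ weightedWedge-untouched N L G w untouched ⟩
      w zero * W′                                       ≡⟨ cong (w zero *_) (subsetSum-tooLarge N (suc L) _ (tail w) (ℕ.≰⇒> L≥N)) ⟩
      w zero * 0                                        ≡⟨ ℕ.*-zeroʳ (w zero) ⟩
      0                                                 ∎
  ... | yes L<N = begin
    weightedWedge (suc N) (suc L) (incidence ∘ G) w * (N ∸ L) ^ (N ∸ L)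
      ≡⟨ cong₂ (λ x k → x * k ^ k) (weightedWedge-untouched N L G w untouched) N∸L≡ ⟩
    w zero * weightedWedge N (suc L) (incidence ∘ contractEdge ∘ G) (tail w) * suc k ^ suc k
      ≤⟨ amgm-step k (w zero) _ (sum (tail w)) (ih (suc L) (contractEdge ∘ G) (tail w)) ⟩
    sum w ^ suc k
      ≡⟨ cong (sum w ^_) (sym N∸L≡) ⟩
    sum w ^ (N ∸ L) ∎
    where
    open ℕ.≤-Reasoning
    k : ℕ
    k = N ∸ suc L
    N∸L≡ : N ∸ L ≡ suc k
    N∸L≡ = ℕ.+-∸-assoc 1 L<N

  bound-oneTouching : ∀ L (G : Fin (suc L) → Edge (suc N)) w j → touches₀ (G j) ≡ true →
    (∀ c → touches₀ (G (punchIn j c)) ≡ false) → WedgeBound (suc N) (suc L) (incidence ∘ G) w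
  bound-oneTouching L G w j touches-j others with touches₀-true (G j) touches-j
  ... | s , nothing , Gj≡ =
    bound-mono (N ∸ L) (ℕ.≤-reflexive W≡) (ℕ.m≤n+m (sum (tail w)) (w zero)) (ih L (contractEdge ∘ G ∘ punchIn j) (tail w))
    where
    open ≡-Reasoning
    η : Fin L → Fin N → ℤ
    η = incidence ∘ contractEdge ∘ G ∘ punchIn j
    c : Fin N → ℤ
    c i = (opposite s ◃ 1) ℤ.* 0ℤ
    W′ : ℕ
    W′ = weightedWedge N L η (tail w)
    W≡ : weightedWedge (suc N) (suc L) (incidence ∘ G) w ≡ W′
    W≡ = begin
      weightedWedge (suc N) (suc L) (incidence ∘ G) w
        ≡⟨ weightedWedge-oneTouching N L G w j s nothing Gj≡ others ⟩
      W′ + w zero * weightedWedge N (suc L) (c Vector.∷ η) (tail w)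
        ≡⟨ cong (λ x → W′ + w zero * x)
                (weightedWedge-zeroColumn N L (c Vector.∷ η) (tail w) zero λ _ → ℤ.*-zeroʳ (opposite s ◃ 1)) ⟩
      W′ + w zero * 0
        ≡⟨ trans (cong (W′ +_) (ℕ.*-zeroʳ (w zero))) (ℕ.+-identityʳ W′) ⟩
      W′ ∎
  -- contracting the edge between 0 and a moves the weight of 0 onto a
  ... | s , just a  , Gj≡ = bound-mono (N ∸ L) (ℕ.≤-reflexive (trans split absorb))
    (ℕ.≤-reflexive (trans (sum-updateAt-+ (tail w) a (w zero)) (ℕ.+-comm (sum (tail w)) (w zero))))
    (ih L (contractEdge ∘ G ∘ punchIn j) w″)
    where
    η : Fin L → Fin N → ℤ
    η = incidence ∘ contractEdge ∘ G ∘ punchIn j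
    c : Fin N → ℤ
    c i = (opposite s ◃ 1) ℤ.* e a i
    w″ : Fin N → ℕ
    w″ = updateAt (tail w) a (const (tail w a + w zero))
    split : weightedWedge (suc N) (suc L) (incidence ∘ G) w ≡
            weightedWedge N L η (tail w) + w zero * weightedWedge N (suc L) (c Vector.∷ η) (tail w)
    split = weightedWedge-oneTouching N L G w j s (just a) Gj≡ others
    absorb : weightedWedge N L η (tail w) + w zero * weightedWedge N (suc L) (c Vector.∷ η) (tail w) ≡ weightedWedge N L η w″
    absorb = weightedWedge-absorb N L η c a (opposite s ◃ 1) (ℤ.abs-◃ (opposite s) 1) (λ _ → refl) (tail w) (w zero)

  bound-byTouchCount : ∀ n L (G : Fin L → Edge (suc N)) w → count (touches₀ ∘ G) ≤ n → WedgeBound (suc N) L (incidence ∘ G) w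
  bound-byTouchCount n zero G w _ = bound-noEdges G w
  bound-byTouchCount n (suc L) G w count≤n with occurrences (touches₀ ∘ G)
  ... | none untouched          = bound-untouched L G w untouched
  ... | one j touches-j others  = bound-oneTouching L G w j touches-j others
  bound-byTouchCount n (suc zero) G w count≤n | two j () _ _
  bound-byTouchCount (suc n) (suc (suc L)) G w count≤n | two j c touches-j touches-jc =
    let G′ , sameWedge , countDrops = mergeStars G j c touches-j touches-jc in
    bound-mono (N ∸ suc L) (ℕ.≤-reflexive (sameWedge w)) ℕ.≤-refl
      (bound-byTouchCount n (suc (suc L)) G′ w (ℕ.≤-pred (subst (_≤ suc n) (sym countDrops) count≤n)))
  bound-byTouchCount zero (suc (suc L)) G w count≤n | two j c touches-j touches-jc =
    let _ , _ , countDrops = mergeStars G j c touches-j touches-jc in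
    contradiction (subst (_≤ 0) (sym countDrops) count≤n) λ ()

graphBound : ∀ N → GraphBound N
graphBound zero    zero    G w = s≤s z≤n
graphBound zero    (suc L) G w = z≤n
graphBound (suc N) L       G w = bound-byTouchCount N (graphBound N) (count (touches₀ ∘ G)) L G w ℕ.≤-refl

lemma3p9 : (N L : ℕ) → 1 ≤ L → L < N → N ≤ 2 * L →
    (ξ : Fin L → Fin N → ℤ) → (∀ ℓ → InF N (ξ ℓ)) →
    wedgeNorm1 N L ξ * (N ∸ L) ^ (N ∸ L) ≤ N ^ (N ∸ L)
lemma3p9 N L _ _ _ ξ ξ∈F = begin
  wedgeNorm1 N L ξ * k ^ k                               ≡⟨ cong (_* k ^ k) (wedgeNorm1≡weightedWedge N L ξ) ⟩
  weightedWedge N L ξ (λ _ → 1) * k ^ k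
    ≡⟨ cong (_* k ^ k) (weightedWedge-cong N L ξ (incidence ∘ G) ξ≗ (λ _ → 1)) ⟩
  weightedWedge N L (incidence ∘ G) (λ _ → 1) * k ^ k    ≤⟨ graphBound N L G (λ _ → 1) ⟩
  sum {N} (λ _ → 1) ^ k                                  ≡⟨ cong (_^ k) (sum-ones N) ⟩
  N ^ k                                                  ∎
  where
  open ℕ.≤-Reasoning
  k : ℕ
  k = N ∸ L
  G : Fin L → Edge N
  G ℓ = let (m , n , _) = ξ∈F ℓ in just m , just n
  ξ≗ : ∀ ℓ i → ξ ℓ i ≡ incidence (G ℓ) i
  ξ≗ ℓ with ξ∈F ℓ
  ... | _ , _ , _ , ξℓ≡ = ξℓ≡
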